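{- Let $G$ be a nice graph. If $G$ admits an improper twin $k$-edge coloring for some integer $k\geq 2$, then $G$ admits an improper twin $t$-edge coloring for every integer $t\geq k$.
   Context: A graph is nice if it has no connected component isomorphic to $K_2$. For an integer $k\geq 2$, an improper twin $k$-edge coloring of $G$ is a map $s:E(G)\to\mathbb{Z}_k$ (adjacent edges may receive equal colors) such that $c_s(v)=\sum_{e\in E_v}s(e)$ computed in $\mathbb{Z}_k$ (with $E_v$ the set of edges incident to $v$; the empty sum is $0$) is a proper vertex coloring of $G$. -}

module Defs where

open import Data.Nat using (ℕ; zero; suc; _+_; _%_; _≥_; _<_)
open import Data.Fin using (Fin; toℕ; _≟_)
open import Data.Product using (Σ; _×_; _,_; proj₁; proj₂; ∃)
open import Data.List using (List; map; allFin)
open import Data.Nat.ListAction using (sum)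
open import Relation.Nullary using (¬_; yes; no)
open import Relation.Binary.PropositionalEquality using (_≡_; _≢_)
open import Function.Definitions using (Injective)

-- A finite simple graph: vertices Fin n, edges Fin m, each edge e has
-- endpoints (u , v) with toℕ u < toℕ v (no loops, canonical orientation),
-- and distinct edges have distinct endpoint pairs (no multi-edges).
record Graph : Set where
  field
    n     : ℕ
    m     : ℕ
    ends  : Fin m → Fin n × Fin n
    ordered : ∀ e → toℕ (proj₁ (ends e)) < toℕ (proj₂ (ends e))
    simple  : Injective _≡_ _≡_ ends

open Graph public

Incident : (G : Graph) → Fin (m G) → Fin (n G) → Set
Incident G e v = (proj₁ (ends G e) ≡ v) Data.Sum.⊎ (proj₂ (ends G e) ≡ v)
  where import Data.Sum

Adjacent : (G : Graph) → Fin (n G) → Fin (n G) → Set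
Adjacent G u v = ∃ λ e → (ends G e ≡ (u , v)) Data.Sum.⊎ (ends G e ≡ (v , u))
  where import Data.Sum

-- A connected component isomorphic to K₂ in a simple graph is exactly an
-- edge e such that no other edge is incident to either endpoint of e.
-- G is nice if it has no such component.
Nice : Graph → Set
Nice G = ¬ (Σ (Fin (m G)) λ e →
              ∀ f → f ≢ e →
                ¬ Incident G f (proj₁ (ends G e)) × ¬ Incident G f (proj₂ (ends G e)))

contrib : (G : Graph) {k : ℕ} → (Fin (m G) → Fin k) → Fin (n G) → Fin (m G) → ℕ
contrib G s v e with proj₁ (ends G e) ≟ v | proj₂ (ends G e) ≟ v
... | yes _ | _     = toℕ (s e)
... | no _  | yes _ = toℕ (s e)
... | no _  | no _  = 0

-- c_s(v) = Σ_{e ∈ E_v} s(e), computed in ℤ_k (represented as a residue in ℕ)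
vertexSum : (G : Graph) (k : ℕ) → (Fin (m G) → Fin k) → Fin (n G) → ℕ
vertexSum G zero    s v = 0
vertexSum G (suc k) s v = sum (map (contrib G s v) (allFin (m G))) % suc k

IsImproperTwinColoring : (G : Graph) (k : ℕ) → (Fin (m G) → Fin k) → Set
IsImproperTwinColoring G k s =
  ∀ u v → Adjacent G u v → vertexSum G k s u ≢ vertexSum G k s v

AdmitsImproperTwin : Graph → ℕ → Set
AdmitsImproperTwin G k = Σ (Fin (m G) → Fin k) λ s → IsImproperTwinColoring G k s

-- Let c < k be the vertex colours of the given twin k-colouring. It suffices to find a proper
-- T : V → [0, t) and integer edge weights whose vertex sums are ≡ T mod t, since the weights
-- reduced mod t then form a twin t-colouring. Such weights exist once T satisfies one condition
-- per component. Every vertex sends its value to the least vertex z of its component along a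
-- walk carrying alternately ±T v, so z receives T v or −T v according to the parity of the walk.
-- In a non-bipartite component all these walks can be taken odd, and an odd closed walk at z
-- adds any even number at z, so the condition is that the sum of T over the component is even;
-- in a bipartite component it is that both sides have the same sum mod t. Non-bipartite
-- components keep T = c, except that one vertex is recoloured k or k − 1 when the sum is odd
-- (possible as k < t). Bipartite components get 1 on one side and 0 on the other, corrected at
-- the root and at most two further vertices; this is where t ≥ 3 and niceness are needed.
-- Existence of walks is decidable only under double negation, which suffices because
-- admitting a twin t-colouring is decidable.

module Submission where

open import Defs
open import Data.Bool.Base using (Bool; true; false; not; _xor_; _∨_)
open import Data.Bool.Properties using (not-distribˡ-xor; xor-comm; true-xor; not-¬)
import Data.Bool.Properties as Bool
open import Data.Empty using (⊥-elim)
open import Data.Fin.Base as Fin using (Fin; zero; suc; toℕ; fromℕ<; finToFun; funToFin)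
import Data.Fin.Properties as Fin
open import Data.Fin.Properties using (finToFun-funToFin)
open import Data.Product.Properties using (≡-dec)
import Data.List.Properties
open import Data.Integer.Base as ℤ using (ℤ; +_; -[1+_]; -_; _+_; _-_; _*_; _%ℕ_; _/ℕ_)
import Data.Integer.Properties as ℤ
open import Data.Integer.DivMod using (n%ℕd<d; a≡a%ℕn+[a/ℕn]*n)
open import Data.Integer.Divisibility.Signed
  using (_∣_; _∣?_; divides; ∣-refl; ∣⇒∣ᵤ; ∣m∣n⇒∣m+n; ∣m∣n⇒∣m-n; ∣m⇒∣-m; ∣n⇒∣m*n)
import Data.Nat.Divisibility as ℕ
open import Data.Integer.Tactic.RingSolver using (solve-∀)
open import Data.Nat.Base as ℕ using (ℕ; NonZero; _<_; _≥_)
import Data.Nat.DivMod as ℕ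
import Data.Nat.Properties as ℕ
open import Data.Product using (Σ; ∃; ∃₂; _×_; _,_; proj₁; proj₂)
open import Data.Sum using (_⊎_; inj₁; inj₂)
import Data.Sum as Sum
open import Function.Base using (_∘_; const; id)
open import Data.List.Base using (map; allFin; tabulate)
open import Data.Vec.Functional using (updateAt)
open import Data.Vec.Functional.Properties using (updateAt-updates; updateAt-minimal)
open import Data.Nat.ListAction using () renaming (sum to listSum)
open import Relation.Binary.PropositionalEquality
open import Relation.Binary.Bundles using (Setoid)
import Relation.Binary.Reasoning.Setoid as SetoidReasoning
open import Relation.Nullary using (¬_; Dec; yes; no; does)
open import Relation.Nullary.Negation using (¬¬-map)
open import Relation.Nullary.Decidable
  using (¬?; _×-dec_; _⊎-dec_; _→-dec_; map′; decidable-stable; dec-false; ¬¬-excluded-middle)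
open import Axiom.UniquenessOfIdentityProofs using (module Decidable⇒UIP)
open import Algebra.Properties.Semiring.Sum ℤ.+-*-semiring
  using (sum; sum-syntax; sum-cong-≗; ∑-distrib-+; ∑-comm; *-distribˡ-sum)

private
  variable
    N : ℕ

∑-zero : (f : Fin N → ℤ) → (∀ i → f i ≡ + 0) → sum f ≡ + 0
∑-zero {ℕ.zero}  f f≡0 = refl
∑-zero {ℕ.suc N} f f≡0 = cong₂ _+_ (f≡0 zero) (∑-zero (f ∘ suc) (f≡0 ∘ suc))

∑-single : (f : Fin N → ℤ) (j : Fin N) → (∀ i → i ≢ j → f i ≡ + 0) → sum f ≡ f j
∑-single {ℕ.suc N} f zero    f≡0 =
  trans (cong (λ s → f zero + s) (∑-zero (f ∘ suc) (λ i → f≡0 (suc i) λ ()))) (ℤ.+-identityʳ (f zero))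
∑-single {ℕ.suc N} f (suc j) f≡0 =
  trans (cong (λ x → x + sum (f ∘ suc)) (f≡0 zero λ ()))
        (trans (ℤ.+-identityˡ _) (∑-single (f ∘ suc) j λ i i≢j → f≡0 (suc i) (i≢j ∘ Fin.suc-injective)))

∑-nonzero : (f : Fin N → ℤ) → sum f ≢ + 0 → ∃ λ i → f i ≢ + 0
∑-nonzero f ∑f≢0 with Fin.any? (λ i → ¬? (f i ℤ.≟ + 0))
... | yes found = found
... | no none = ⊥-elim (∑f≢0 (∑-zero f λ i → decidable-stable (f i ℤ.≟ + 0) λ fi≢0 → none (i , fi≢0)))

infix 4 _≡_mod_

record _≡_mod_ (a b : ℤ) (t : ℕ) : Set where
  constructor mod-by
  field divides-difference : + t ∣ a - b

module _ {t : ℕ} where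

  ≡⇒≡-mod : ∀ {a b} → a ≡ b → a ≡ b mod t
  ≡⇒≡-mod {a} refl = mod-by (divides (+ 0) (ℤ.+-inverseʳ a))

  ≡-mod-sym : ∀ {a b} → a ≡ b mod t → b ≡ a mod t
  ≡-mod-sym {a} {b} (mod-by t∣a-b) = mod-by (subst (+ t ∣_) (swap a b) (∣m⇒∣-m t∣a-b))
    where
    swap : ∀ a b → - (a - b) ≡ b - a
    swap = solve-∀

  ≡-mod-trans : ∀ {a b c} → a ≡ b mod t → b ≡ c mod t → a ≡ c mod t
  ≡-mod-trans {a} {b} {c} (mod-by t∣a-b) (mod-by t∣b-c) =
    mod-by (subst (+ t ∣_) (telescope a b c) (∣m∣n⇒∣m+n t∣a-b t∣b-c))
    where
    telescope : ∀ a b c → a - b + (b - c) ≡ a - c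
    telescope = solve-∀

  +-cong-mod : ∀ {a b c d} → a ≡ b mod t → c ≡ d mod t → a + c ≡ b + d mod t
  +-cong-mod {a} {b} {c} {d} (mod-by t∣a-b) (mod-by t∣c-d) =
    mod-by (subst (+ t ∣_) (regroup a b c d) (∣m∣n⇒∣m+n t∣a-b t∣c-d))
    where
    regroup : ∀ a b c d → a - b + (c - d) ≡ a + c - (b + d)
    regroup = solve-∀

  +-congˡ-mod : ∀ c {a b} → a ≡ b mod t → c + a ≡ c + b mod t
  +-congˡ-mod c = +-cong-mod (≡⇒≡-mod {a = c} refl)

  +-congʳ-mod : ∀ c {a b} → a ≡ b mod t → a + c ≡ b + c mod t
  +-congʳ-mod c a≡b = +-cong-mod a≡b (≡⇒≡-mod {a = c} refl)

  neg-cong-mod : ∀ {a b} → a ≡ b mod t → - a ≡ - b mod t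
  neg-cong-mod {a} {b} (mod-by t∣a-b) = mod-by (subst (+ t ∣_) (push a b) (∣m⇒∣-m t∣a-b))
    where
    push : ∀ a b → - (a - b) ≡ - a - - b
    push = solve-∀

  *-congˡ-mod : ∀ c {a b} → a ≡ b mod t → c * a ≡ c * b mod t
  *-congˡ-mod c {a} {b} (mod-by t∣a-b) = mod-by (subst (+ t ∣_) (distrib c a b) (∣n⇒∣m*n c t∣a-b))
    where
    distrib : ∀ c a b → c * (a - b) ≡ c * a - c * b
    distrib = solve-∀

  ∑-cong-mod : (f g : Fin N → ℤ) → (∀ i → f i ≡ g i mod t) → sum f ≡ sum g mod t
  ∑-cong-mod {ℕ.zero}  f g f≡g = ≡⇒≡-mod refl
  ∑-cong-mod {ℕ.suc N} f g f≡g = +-cong-mod (f≡g zero) (∑-cong-mod (f ∘ suc) (g ∘ suc) (f≡g ∘ suc))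

  +-multiple-mod : ∀ a q → a + q * + t ≡ a mod t
  +-multiple-mod a q = mod-by (divides q (cancel a (q * + t)))
    where
    cancel : ∀ a b → a + b - a ≡ b
    cancel = solve-∀

  multiple-mod : ∀ q → q * + t ≡ + 0 mod t
  multiple-mod q = mod-by (divides q (ℤ.+-identityʳ (q * + t)))

  %ℕ-mod : .{{_ : NonZero t}} → ∀ a → + (a %ℕ t) ≡ a mod t
  %ℕ-mod a = ≡-mod-sym (subst (λ b → b ≡ + (a %ℕ t) mod t) (sym (a≡a%ℕn+[a/ℕn]*n a t))
                          (+-multiple-mod (+ (a %ℕ t)) (a /ℕ t)))

  ≡-mod⇒≡ : ∀ {a b} → a < t → b < t → + a ≡ + b mod t → a ≡ b
  ≡-mod⇒≡ {a} {b} a<t b<t (mod-by (divides q a-b≡qt)) = by-sign q a-b≡qt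
    where
    instance
      _ : NonZero t
      _ = ℕ.>-nonZero (ℕ.≤-<-trans ℕ.z≤n a<t)

    reduce : ∀ {x y} j → x < t → y < t → + x - + y ≡ + j * + t → x ≡ y
    reduce {x} {y} j x<t y<t x-y≡jt = begin
      x                      ≡⟨ ℕ.m<n⇒m%n≡m x<t ⟨
      x ℕ.% t                ≡⟨ cong (ℕ._% t) (ℤ.+-injective x≡y+jt) ⟩
      (y ℕ.+ j ℕ.* t) ℕ.% t  ≡⟨ ℕ.[m+kn]%n≡m%n y j t ⟩
      y ℕ.% t                ≡⟨ ℕ.m<n⇒m%n≡m y<t ⟩
      y                      ∎
      where
      open ≡-Reasoning
      split : ∀ x y → x ≡ y + (x - y)
      split = solve-∀
      x≡y+jt : + x ≡ + (y ℕ.+ j ℕ.* t)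
      x≡y+jt = begin
        + x                  ≡⟨ split (+ x) (+ y) ⟩
        + y + (+ x - + y)    ≡⟨ cong (λ d → + y + d) x-y≡jt ⟩
        + y + + j * + t      ≡⟨ cong (λ d → + y + d) (ℤ.pos-* j t) ⟨
        + y + + (j ℕ.* t)    ≡⟨ ℤ.pos-+ y (j ℕ.* t) ⟨
        + (y ℕ.+ j ℕ.* t)    ∎

    by-sign : ∀ q → + a - + b ≡ q * + t → a ≡ b
    by-sign (+ j)    a-b≡jt = reduce j a<t b<t a-b≡jt
    by-sign -[1+ j ] a-b≡qt = sym (reduce (ℕ.suc j) b<t a<t
      (trans (swap (+ a) (+ b)) (trans (cong -_ a-b≡qt) (ℤ.neg-distribˡ-* -[1+ j ] (+ t)))))
      where
      swap : ∀ a b → b - a ≡ - (a - b)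
      swap = solve-∀

module ≡-mod-Reasoning (t : ℕ) where

  ≡-mod-setoid : Setoid _ _
  ≡-mod-setoid = record
    { Carrier       = ℤ
    ; _≈_           = λ a b → a ≡ b mod t
    ; isEquivalence = record { refl = ≡⇒≡-mod refl ; sym = ≡-mod-sym ; trans = ≡-mod-trans }
    }

  open SetoidReasoning ≡-mod-setoid public

¬2∣1 : ¬ (+ 2 ∣ + 1)
¬2∣1 2∣1 with ℕ.∣⇒≤ (∣⇒∣ᵤ 2∣1)
... | ℕ.s≤s ()

odd⇒2∣pred : ∀ {a} → ¬ (+ 2 ∣ a) → + 2 ∣ a - + 1
odd⇒2∣pred {a} ¬2∣a with a %ℕ 2 | n%ℕd<d a 2 | a≡a%ℕn+[a/ℕn]*n a 2
... | 0 | _ | a≡2q   = ⊥-elim (¬2∣a (divides (a /ℕ 2) (trans a≡2q (ℤ.+-identityˡ _))))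
... | 1 | _ | a≡1+2q = divides (a /ℕ 2) (trans (cong (_- + 1) a≡1+2q) (cancel (a /ℕ 2 * + 2)))
  where
  cancel : ∀ x → + 1 + x - + 1 ≡ x
  cancel = solve-∀
... | ℕ.suc (ℕ.suc _) | ℕ.s≤s (ℕ.s≤s ()) | _

even⇒odd-pred : ∀ {a} → + 2 ∣ a → ¬ (+ 2 ∣ a - + 1)
even⇒odd-pred {a} 2∣a 2∣a-1 = ¬2∣1 (subst (+ 2 ∣_) (difference a) (∣m∣n⇒∣m-n 2∣a 2∣a-1))
  where
  difference : ∀ a → a - (a - + 1) ≡ + 1
  difference = solve-∀

odd+odd : ∀ {a b} → ¬ (+ 2 ∣ a) → ¬ (+ 2 ∣ b) → + 2 ∣ a + b
odd+odd {a} {b} ¬2∣a ¬2∣b =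
  subst (+ 2 ∣_) (regroup a b) (∣m∣n⇒∣m+n (∣m∣n⇒∣m+n (odd⇒2∣pred ¬2∣a) (odd⇒2∣pred ¬2∣b)) (∣-refl {+ 2}))
  where
  regroup : ∀ a b → a - + 1 + (b - + 1) + + 2 ≡ a + b
  regroup = solve-∀

infix 5 _↦_

_↦_ : Fin N → ℤ → Fin N → ℤ
(a ↦ x) z with a Fin.≟ z
... | yes _ = x
... | no  _ = + 0

↦-≡ : ∀ {a z : Fin N} x → a ≡ z → (a ↦ x) z ≡ x
↦-≡ {a = a} x refl with a Fin.≟ a
... | yes _   = refl
... | no  a≢a = ⊥-elim (a≢a refl)

↦-≢ : ∀ {a z : Fin N} x → a ≢ z → (a ↦ x) z ≡ + 0
↦-≢ {a = a} {z} x a≢z with a Fin.≟ z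
... | yes a≡z = ⊥-elim (a≢z a≡z)
... | no  _   = refl

↦-zero : (a z : Fin N) → (a ↦ + 0) z ≡ + 0
↦-zero a z with a Fin.≟ z
... | yes _ = refl
... | no  _ = refl

↦-neg : (a z : Fin N) (x : ℤ) → (a ↦ - x) z ≡ - (a ↦ x) z
↦-neg a z x with a Fin.≟ z
... | yes _ = refl
... | no  _ = refl

↦-+ : (a z : Fin N) (x y : ℤ) → (a ↦ x + y) z ≡ (a ↦ x) z + (a ↦ y) z
↦-+ a z x y with a Fin.≟ z
... | yes _ = refl
... | no  _ = refl

∑-↦ : (f : Fin N → ℤ) (z : Fin N) → ∑[ a < N ] (a ↦ f a) z ≡ f z
∑-↦ f z = trans (∑-single _ z λ a a≢z → ↦-≢ (f a) a≢z) (↦-≡ (f z) refl)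

∑-*↦ : (g : Fin N → ℤ) (a : Fin N) (x : ℤ) → ∑[ i < N ] (g i * (a ↦ x) i) ≡ g a * x
∑-*↦ g a x = trans (∑-single _ a λ i i≢a → trans (cong (g i *_) (↦-≢ x (i≢a ∘ sym))) (ℤ.*-zeroʳ (g i)))
                   (cong (g a *_) (↦-≡ x refl))

-- sign p x is what a walk of parity p carrying x on its first edge delivers at its far end.
sign : Bool → ℤ → ℤ
sign true  x = x
sign false x = - x

sign-+ : ∀ p x y → sign p (x + y) ≡ sign p x + sign p y
sign-+ true  x y = refl
sign-+ false x y = ℤ.neg-distrib-+ x y

sign-zero : ∀ p → sign p (+ 0) ≡ + 0
sign-zero true  = refl
sign-zero false = refl

sign-neg : ∀ p x → sign p (- x) ≡ sign (not p) x
sign-neg true  x = refl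
sign-neg false x = ℤ.neg-involutive x

+-updateAt : (f : Fin N → ℕ) (i : Fin N) (a : ℕ) (j : Fin N) →
             + updateAt f i (const a) j ≡ + f j + (i ↦ + a - + f i) j
+-updateAt f i a j with j Fin.≟ i
... | yes refl = begin
  + updateAt f i (const a) i    ≡⟨ cong +_ (updateAt-updates i f) ⟩
  + a                           ≡⟨ cancel (+ f i) (+ a) ⟨
  + f i + (+ a - + f i)         ≡⟨ cong (λ x → + f i + x) (↦-≡ {a = i} (+ a - + f i) refl) ⟨
  + f i + (i ↦ + a - + f i) i   ∎
  where
  open ≡-Reasoning
  cancel : ∀ x y → x + (y - x) ≡ y
  cancel = solve-∀
... | no j≢i = begin
  + updateAt f i (const a) j    ≡⟨ cong +_ (updateAt-minimal j i f j≢i) ⟩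
  + f j                         ≡⟨ ℤ.+-identityʳ (+ f j) ⟨
  + f j + + 0                   ≡⟨ cong (λ x → + f j + x) (↦-≢ (+ a - + f i) (j≢i ∘ sym)) ⟨
  + f j + (i ↦ + a - + f i) j   ∎
  where open ≡-Reasoning

updateAt-< : ∀ {b} (f : Fin N → ℕ) (i : Fin N) {a} → (∀ j → f j < b) → a < b → ∀ j → updateAt f i (const a) j < b
updateAt-< {b = b} f i f<b a<b j with j Fin.≟ i
... | yes refl = subst (_< b) (sym (updateAt-updates i f)) a<b
... | no j≢i   = subst (_< b) (sym (updateAt-minimal j i f j≢i)) (f<b j)

module Walks (G : Graph) where

  Vertex Edge : Set
  Vertex = Fin (n G)
  Edge   = Fin (m G)

  adjacent-sym : ∀ {u v} → Adjacent G u v → Adjacent G v u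
  adjacent-sym (e , e≡uv⊎e≡vu) = e , Sum.swap e≡uv⊎e≡vu

  ends-distinct : ∀ e → proj₁ (ends G e) ≢ proj₂ (ends G e)
  ends-distinct e eq = ℕ.<-irrefl (cong toℕ eq) (ordered G e)

  edges-unreversed : ∀ {e e′ u v} → ends G e ≡ (u , v) → ends G e′ ≢ (v , u)
  edges-unreversed {e} {e′} refl e′≡vu =
    ℕ.<-asym (ordered G e) (subst (λ p → toℕ (proj₁ p) < toℕ (proj₂ p)) e′≡vu (ordered G e′))

  adjacent-irrefl : ∀ {v} → ¬ Adjacent G v v
  adjacent-irrefl (e , inj₁ e≡vv) = edges-unreversed e≡vv e≡vv
  adjacent-irrefl (e , inj₂ e≡vv) = edges-unreversed e≡vv e≡vv

  edge-unique : ∀ {u v} (a a′ : Adjacent G u v) → proj₁ a ≡ proj₁ a′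
  edge-unique (e , inj₁ e≡uv) (e′ , inj₁ e′≡uv) = simple G (trans e≡uv (sym e′≡uv))
  edge-unique (e , inj₂ e≡vu) (e′ , inj₂ e′≡vu) = simple G (trans e≡vu (sym e′≡vu))
  edge-unique (e , inj₁ e≡uv) (e′ , inj₂ e′≡vu) = ⊥-elim (edges-unreversed e≡uv e′≡vu)
  edge-unique (e , inj₂ e≡vu) (e′ , inj₁ e′≡uv) = ⊥-elim (edges-unreversed e≡vu e′≡uv)

  incident⇒adjacent : ∀ {f x} → Incident G f x → ∃ λ q → Σ (Adjacent G x q) λ a → proj₁ a ≡ f
  incident⇒adjacent {f} (inj₁ refl) = proj₂ (ends G f) , (f , inj₁ refl) , refl
  incident⇒adjacent {f} (inj₂ refl) = proj₁ (ends G f) , (f , inj₂ refl) , refl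

  nice⇒adjacentEdge : Nice G → ∀ {u v} (a : Adjacent G u v) →
                      ∃ λ f → f ≢ proj₁ a × (Incident G f u ⊎ Incident G f v)
  nice⇒adjacentEdge nice {u} {v} (e , e≡uv)
    with Fin.any? (λ f → ¬? (f Fin.≟ e) ×-dec (incident? f u ⊎-dec incident? f v))
    where
    incident? : ∀ f x → Dec (Incident G f x)
    incident? f x = (proj₁ (ends G f) Fin.≟ x) ⊎-dec (proj₂ (ends G f) Fin.≟ x)
  ... | yes found = found
  ... | no  none  = ⊥-elim (nice (e , λ f f≢e → isolated f f≢e e≡uv))
    where
    isolated : ∀ f → f ≢ e → ends G e ≡ (u , v) ⊎ ends G e ≡ (v , u) →
               ¬ Incident G f (proj₁ (ends G e)) × ¬ Incident G f (proj₂ (ends G e))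
    isolated f f≢e (inj₁ refl) = (λ i → none (f , f≢e , inj₁ i)) , (λ i → none (f , f≢e , inj₂ i))
    isolated f f≢e (inj₂ refl) = (λ i → none (f , f≢e , inj₂ i)) , (λ i → none (f , f≢e , inj₁ i))

  -- Walks indexed by the parity of their length (true = odd)

  infixr 5 _∷_

  data Walk : Vertex → Vertex → Bool → Set where
    []  : ∀ {u} → Walk u u false
    _∷_ : ∀ {u v w p} → Adjacent G u v → Walk v w p → Walk u w (not p)

  infixr 5 _++_

  _++_ : ∀ {u v w p q} → Walk u v p → Walk v w q → Walk u w (p xor q)
  [] ++ W = W
  _++_ {q = q} (_∷_ {p = p} a W₁) W₂ = subst (Walk _ _) (not-distribˡ-xor p q) (a ∷ W₁ ++ W₂)

  reverse : ∀ {u v p} → Walk u v p → Walk v u p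
  reverse []                  = []
  reverse (_∷_ {p = p} a W) =
    subst (Walk _ _) (trans (xor-comm p true) (true-xor p)) (reverse W ++ adjacent-sym a ∷ [])

  firstStep : ∀ {u v p} → Walk u v p → p ≡ true → ∃ (Adjacent G u)
  firstStep (a ∷ _) _ = _ , a

  -- Integer edge weights

  incidence : Vertex → Edge → ℤ
  incidence v e with proj₁ (ends G e) Fin.≟ v | proj₂ (ends G e) Fin.≟ v
  ... | yes _ | _     = + 1
  ... | no  _ | yes _ = + 1
  ... | no  _ | no  _ = + 0

  weightSum : (Edge → ℤ) → Vertex → ℤ
  weightSum w v = ∑[ e < m G ] (incidence v e * w e)

  weightSum-+ : ∀ w₁ w₂ v → weightSum (λ e → w₁ e + w₂ e) v ≡ weightSum w₁ v + weightSum w₂ v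
  weightSum-+ w₁ w₂ v =
    trans (sum-cong-≗ λ e → ℤ.*-distribˡ-+ (incidence v e) (w₁ e) (w₂ e))
          (∑-distrib-+ (λ e → incidence v e * w₁ e) (λ e → incidence v e * w₂ e))

  weightSum-∑ : (w : Fin N → Edge → ℤ) → ∀ v → weightSum (λ e → ∑[ i < N ] w i e) v ≡ ∑[ i < N ] weightSum (w i) v
  weightSum-∑ w v = trans (sum-cong-≗ λ e → *-distribˡ-sum (incidence v e) (λ i → w i e))
                          (∑-comm (λ e i → incidence v e * w i e))

  weightSum-zero : ∀ v → weightSum (const (+ 0)) v ≡ + 0
  weightSum-zero v = ∑-zero _ λ e → ℤ.*-zeroʳ (incidence v e)

  incidence-* : ∀ v e x → incidence v e * x ≡ (proj₁ (ends G e) ↦ x) v + (proj₂ (ends G e) ↦ x) v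
  incidence-* v e x with proj₁ (ends G e) Fin.≟ v | proj₂ (ends G e) Fin.≟ v
  ... | yes e₁≡v | yes e₂≡v = ⊥-elim (ends-distinct e (trans e₁≡v (sym e₂≡v)))
  ... | yes _    | no  _    = trans (ℤ.*-identityˡ x) (sym (ℤ.+-identityʳ x))
  ... | no  _    | yes _    = trans (ℤ.*-identityˡ x) (sym (ℤ.+-identityˡ x))
  ... | no  _    | no  _    = refl

  weightSum-edge : ∀ {u v} (a : Adjacent G u v) x z → weightSum (proj₁ a ↦ x) z ≡ (u ↦ x) z + (v ↦ x) z
  weightSum-edge (e , e≡uv) x z = trans (∑-*↦ (incidence z) e x) (trans (incidence-* z e x) (by-ends e≡uv))
    where
    by-ends : ∀ {u v} → ends G e ≡ (u , v) ⊎ ends G e ≡ (v , u) →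
              (proj₁ (ends G e) ↦ x) z + (proj₂ (ends G e) ↦ x) z ≡ (u ↦ x) z + (v ↦ x) z
    by-ends (inj₁ refl) = refl
    by-ends {u} {v} (inj₂ refl) = ℤ.+-comm ((v ↦ x) z) ((u ↦ x) z)

  walkWeight : ∀ {u v p} → Walk u v p → ℤ → Edge → ℤ
  walkWeight []      x e = + 0
  walkWeight (a ∷ W) x e = (proj₁ a ↦ x) e + walkWeight W (- x) e

  weightSum-walkWeight : ∀ {u v p} (W : Walk u v p) x z →
                         weightSum (walkWeight W x) z ≡ (u ↦ x) z + (v ↦ sign p x) z
  weightSum-walkWeight {u} [] x z = begin
    weightSum (const (+ 0)) z          ≡⟨ weightSum-zero z ⟩
    + 0                                ≡⟨ ℤ.+-inverseʳ ((u ↦ x) z) ⟨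
    (u ↦ x) z - (u ↦ x) z              ≡⟨ cong (λ b → (u ↦ x) z + b) (↦-neg u z x) ⟨
    (u ↦ x) z + (u ↦ - x) z            ∎
    where open ≡-Reasoning
  weightSum-walkWeight {u} {w} (_∷_ {v = v} {p = p} a W) x z = begin
    weightSum (walkWeight (a ∷ W) x) z
      ≡⟨ weightSum-+ (proj₁ a ↦ x) (walkWeight W (- x)) z ⟩
    weightSum (proj₁ a ↦ x) z + weightSum (walkWeight W (- x)) z
      ≡⟨ cong₂ _+_ (weightSum-edge a x z) (weightSum-walkWeight W (- x) z) ⟩
    (u ↦ x) z + (v ↦ x) z + ((v ↦ - x) z + (w ↦ sign p (- x)) z)
      ≡⟨ cong₂ (λ b c → (u ↦ x) z + (v ↦ x) z + (b + (w ↦ c) z)) (↦-neg v z x) (sign-neg p x) ⟩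
    (u ↦ x) z + (v ↦ x) z + (- (v ↦ x) z + (w ↦ sign (not p) x) z)
      ≡⟨ cancel ((u ↦ x) z) ((v ↦ x) z) ((w ↦ sign (not p) x) z) ⟩
    (u ↦ x) z + (w ↦ sign (not p) x) z ∎
    where
    open ≡-Reasoning
    cancel : ∀ a b c → a + b + (- b + c) ≡ a + c
    cancel = solve-∀

  reduceMod : ∀ t .{{_ : NonZero t}} → (Edge → ℤ) → Edge → Fin t
  reduceMod t w e = fromℕ< (n%ℕd<d (w e) t)

  contrib≡incidence-* : ∀ {k} (s : Edge → Fin k) v e → + contrib G s v e ≡ incidence v e * + toℕ (s e)
  contrib≡incidence-* s v e with proj₁ (ends G e) Fin.≟ v | proj₂ (ends G e) Fin.≟ v
  ... | yes _ | _     = sym (ℤ.*-identityˡ _)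
  ... | no  _ | yes _ = sym (ℤ.*-identityˡ _)
  ... | no  _ | no  _ = refl

  vertexSum-reduceMod : ∀ t w v → + vertexSum G (ℕ.suc t) (reduceMod (ℕ.suc t) w) v ≡ weightSum w v mod ℕ.suc t
  vertexSum-reduceMod t w v = begin
    + (L ℕ.% ℕ.suc t)                        ≈⟨ %ℕ-mod (+ L) ⟩
    + L                                      ≡⟨ +-sum-tabulate (m G) id ⟩
    ∑[ e < m G ] (+ contrib G s v e)         ≈⟨ ∑-cong-mod _ _ reduced ⟩
    weightSum w v                            ∎
    where
    s = reduceMod (ℕ.suc t) w
    L = listSum (map (contrib G s v) (allFin (m G)))
    +-sum-tabulate : ∀ M (g : Fin M → Edge) →
                     + listSum (map (contrib G s v) (tabulate g)) ≡ ∑[ i < M ] (+ contrib G s v (g i))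
    +-sum-tabulate ℕ.zero    g = refl
    +-sum-tabulate (ℕ.suc M) g =
      trans (ℤ.pos-+ (contrib G s v (g zero)) _)
            (cong (λ r → + contrib G s v (g zero) + r) (+-sum-tabulate M (g ∘ suc)))
    open ≡-mod-Reasoning (ℕ.suc t)
    reduced : ∀ e → + contrib G s v e ≡ incidence v e * w e mod ℕ.suc t
    reduced e = begin
      + contrib G s v e                      ≡⟨ contrib≡incidence-* s v e ⟩
      incidence v e * + toℕ (s e)            ≡⟨ cong (λ x → incidence v e * + x) (Fin.toℕ-fromℕ< _) ⟩
      incidence v e * + (w e %ℕ ℕ.suc t)     ≈⟨ *-congˡ-mod (incidence v e) (%ℕ-mod (w e)) ⟩
      incidence v e * w e                    ∎

  admitsTwin-byWeights : ∀ t (w : Edge → ℤ) (T : Vertex → ℕ) → (∀ v → T v < ℕ.suc t) →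
                         (∀ u v → Adjacent G u v → T u ≢ T v) →
                         (∀ v → weightSum w v ≡ + T v mod ℕ.suc t) → AdmitsImproperTwin G (ℕ.suc t)
  admitsTwin-byWeights t w T T<t T-proper w≡T = s , λ u v u~v sums≡ →
    T-proper u v u~v (≡-mod⇒≡ (T<t u) (T<t v) (begin
      + T u                           ≈⟨ ≡-mod-sym (targetMod u) ⟩
      + vertexSum G (ℕ.suc t) s u     ≡⟨ cong +_ sums≡ ⟩
      + vertexSum G (ℕ.suc t) s v     ≈⟨ targetMod v ⟩
      + T v                           ∎))
    where
    open ≡-mod-Reasoning (ℕ.suc t)
    s = reduceMod (ℕ.suc t) w
    targetMod : ∀ v → + vertexSum G (ℕ.suc t) s v ≡ + T v mod ℕ.suc t
    targetMod v = ≡-mod-trans (vertexSum-reduceMod t w v) (w≡T v)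

record Least {N} (P : Fin N → Set) : Set where
  field
    elem    : Fin N
    holds   : P elem
    minimal : ∀ {j} → P j → elem Fin.≤ j

least : {P : Fin N → Set} → (∀ i → Dec (P i)) → ∃ P → Least P
least {ℕ.suc N} P? (i , Pi) with P? zero
... | yes P0 = record { elem = zero ; holds = P0 ; minimal = λ _ → ℕ.z≤n }
least {ℕ.suc N} P? (zero  , P0) | no ¬P0 = ⊥-elim (¬P0 P0)
least {ℕ.suc N} P? (suc i , Pi) | no ¬P0 = record
  { elem    = suc (Least.elem L)
  ; holds   = Least.holds L
  ; minimal = λ { {zero} P0 → ⊥-elim (¬P0 P0) ; {suc j} Pj → ℕ.s≤s (Least.minimal L Pj) }
  }
  where L = least (P? ∘ suc) (i , Pi)

least-unique : {P Q : Fin N → Set} → (∀ {i} → P i → Q i) → (∀ {i} → Q i → P i) →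
               (L : Least P) (L′ : Least Q) → Least.elem L ≡ Least.elem L′
least-unique P⇒Q Q⇒P L L′ =
  Fin.≤-antisym (Least.minimal L (Q⇒P (Least.holds L′))) (Least.minimal L′ (P⇒Q (Least.holds L)))

-- Components, given decidable existence of walks

module Components (G : Graph) (walk? : ∀ p u v → Dec (Walks.Walk G u v p)) where

  open Walks G

  Connected : Vertex → Vertex → Set
  Connected u v = ∃ (Walk u v)

  connected? : ∀ u v → Dec (Connected u v)
  connected? u v with walk? true u v | walk? false u v
  ... | yes W | _     = yes (true , W)
  ... | no  _ | yes W = yes (false , W)
  ... | no ¬W | no ¬W′ = no λ { (true , W) → ¬W W ; (false , W) → ¬W′ W }

  connected-sym : ∀ {u v} → Connected u v → Connected v u
  connected-sym (p , W) = p , reverse W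

  connected-trans : ∀ {u v w} → Connected u v → Connected v w → Connected u w
  connected-trans (p , W) (q , W′) = p xor q , W ++ W′

  rootOf : ∀ v → Least (Connected v)
  rootOf v = least (connected? v) (v , false , [])

  root : Vertex → Vertex
  root v = Least.elem (rootOf v)

  root-connected : ∀ v → Connected v (root v)
  root-connected v = Least.holds (rootOf v)

  root-cong : ∀ {u v} → Connected u v → root u ≡ root v
  root-cong u~v = least-unique (connected-trans (connected-sym u~v)) (connected-trans u~v) (rootOf _) (rootOf _)

  root-idem : ∀ v → root (root v) ≡ root v
  root-idem v = root-cong (connected-sym (root-connected v))

  root-adjacent : ∀ {u v} → Adjacent G u v → root u ≡ root v
  root-adjacent a = root-cong (true , a ∷ [])

  -- For a root z, the component of z is bipartite iff there is no odd closed walk at z.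
  OddClosedWalk : Vertex → Set
  OddClosedWalk z = Walk z z true

  side : Vertex → Bool
  side v = proj₁ (root-connected v)

  parity-unique : ∀ {v r p q} → ¬ OddClosedWalk r → Walk v r p → Walk v r q → p ≡ q
  parity-unique {p = true}  {true}  _         _ _  = refl
  parity-unique {p = false} {false} _         _ _  = refl
  parity-unique {p = true}  {false} bipartite W W′ = ⊥-elim (bipartite (reverse W ++ W′))
  parity-unique {p = false} {true}  bipartite W W′ = ⊥-elim (bipartite (reverse W ++ W′))

  side-unique : ∀ {v z p} → root v ≡ z → ¬ OddClosedWalk z → Walk v z p → side v ≡ p
  side-unique refl bipartite W = parity-unique bipartite (proj₂ (root-connected _)) W

  side-root : ∀ {z} → root z ≡ z → ¬ OddClosedWalk z → side z ≡ false
  side-root r bipartite = side-unique r bipartite []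

  side-adjacent : ∀ {u v z} → root u ≡ z → ¬ OddClosedWalk z → Adjacent G u v → side v ≡ not (side u)
  side-adjacent refl bipartite a =
    side-unique (sym (root-adjacent a)) bipartite (adjacent-sym a ∷ proj₂ (root-connected _))

  route : ∀ v → ∃ (Walk v (root v))
  route v with walk? true (root v) (root v) | root-connected v
  ... | yes odd | true  , W = true , W
  ... | yes odd | false , W = true , W ++ odd
  ... | no  _   | p , W     = p , W

  routeParity : Vertex → Bool
  routeParity v = proj₁ (route v)

  routeParity-odd : ∀ {v z} → root v ≡ z → OddClosedWalk z → routeParity v ≡ true
  routeParity-odd {v} refl odd with walk? true (root v) (root v) | root-connected v
  ... | yes _ | true  , _ = refl
  ... | yes _ | false , _ = refl
  ... | no ¬odd | _       = ⊥-elim (¬odd odd)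

  routeParity-bipartite : ∀ {v z} → root v ≡ z → ¬ OddClosedWalk z → routeParity v ≡ side v
  routeParity-bipartite {v} refl bipartite with walk? true (root v) (root v)
  ... | yes odd = ⊥-elim (bipartite odd)
  ... | no  _   = refl

  -- Σ ±f v over the v with root v = z, the sign of v being σ v; zero unless z is a root.
  componentSum : (Vertex → Bool) → (Vertex → ℤ) → Vertex → ℤ
  componentSum σ f z = ∑[ v < n G ] (root v ↦ sign (σ v) (f v)) z

  componentSum-cong : ∀ σ σ′ f f′ {z} → (∀ v → root v ≡ z → sign (σ v) (f v) ≡ sign (σ′ v) (f′ v)) →
                      componentSum σ f z ≡ componentSum σ′ f′ z
  componentSum-cong σ σ′ f f′ {z} f≡f′ = sum-cong-≗ λ v → by-root v (root v Fin.≟ z)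
    where
    by-root : ∀ v → Dec (root v ≡ z) → (root v ↦ sign (σ v) (f v)) z ≡ (root v ↦ sign (σ′ v) (f′ v)) z
    by-root v (yes r) = trans (↦-≡ _ r) (trans (f≡f′ v r) (sym (↦-≡ _ r)))
    by-root v (no ¬r) = trans (↦-≢ _ ¬r) (sym (↦-≢ _ ¬r))

  componentSum-nonroot : ∀ σ f {z} → root z ≢ z → componentSum σ f z ≡ + 0
  componentSum-nonroot σ f ¬r = ∑-zero _ λ v → ↦-≢ _ λ r → ¬r (trans (cong root (sym r)) (trans (root-idem v) r))

  componentSum-shift : ∀ σ f {v₀ z} d → root v₀ ≡ z →
                       componentSum σ (λ v → f v + (v₀ ↦ d) v) z ≡ componentSum σ f z + sign (σ v₀) d
  componentSum-shift σ f {v₀} {z} d r = begin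
    ∑[ v < n G ] (root v ↦ sign (σ v) (f v + (v₀ ↦ d) v)) z
      ≡⟨ sum-cong-≗ (λ v → trans (cong (λ x → (root v ↦ x) z) (sign-+ (σ v) (f v) _)) (↦-+ (root v) z _ _)) ⟩
    ∑[ v < n G ] ((root v ↦ sign (σ v) (f v)) z + (root v ↦ sign (σ v) ((v₀ ↦ d) v)) z)
      ≡⟨ ∑-distrib-+ (λ v → (root v ↦ sign (σ v) (f v)) z) _ ⟩
    componentSum σ f z + ∑[ v < n G ] (root v ↦ sign (σ v) ((v₀ ↦ d) v)) z
      ≡⟨ cong (λ x → componentSum σ f z + x) (∑-single _ v₀ off-v₀) ⟩
    componentSum σ f z + (root v₀ ↦ sign (σ v₀) ((v₀ ↦ d) v₀)) z
      ≡⟨ cong (λ x → componentSum σ f z + x) (trans (↦-≡ _ r) (cong (sign (σ v₀)) (↦-≡ d refl))) ⟩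
    componentSum σ f z + sign (σ v₀) d ∎
    where
    open ≡-Reasoning
    off-v₀ : ∀ v → v ≢ v₀ → (root v ↦ sign (σ v) ((v₀ ↦ d) v)) z ≡ + 0
    off-v₀ v v≢v₀ = trans (cong (λ x → (root v ↦ sign (σ v) x) z) (↦-≢ d (v≢v₀ ∘ sym)))
                          (trans (cong (λ x → (root v ↦ x) z) (sign-zero (σ v))) (↦-zero (root v) z))

  componentSum-updateAt : ∀ σ f {v₀ z} a → root v₀ ≡ z →
    componentSum σ (+_ ∘ updateAt f v₀ (const a)) z ≡ componentSum σ (+_ ∘ f) z + sign (σ v₀) (+ a - + f v₀)
  componentSum-updateAt σ f {v₀} a r =
    trans (componentSum-cong σ σ _ _ λ v _ → cong (sign (σ v)) (+-updateAt f v₀ a v))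
          (componentSum-shift σ (+_ ∘ f) _ r)

  loopWeight : Vertex → ℤ → Edge → ℤ
  loopWeight z y with walk? true z z
  ... | yes odd = walkWeight odd y
  ... | no  _   = const (+ 0)

  loopGain : Vertex → ℤ → ℤ
  loopGain z y with walk? true z z
  ... | yes _ = y + y
  ... | no  _ = + 0

  weightSum-loopWeight : ∀ z y v → weightSum (loopWeight z y) v ≡ (z ↦ loopGain z y) v
  weightSum-loopWeight z y v with walk? true z z
  ... | yes odd = trans (weightSum-walkWeight odd y v) (sym (↦-+ z v y y))
  ... | no  _   = trans (weightSum-zero v) (sym (↦-zero z v))

  realizingWeight : (T y : Vertex → ℤ) → Edge → ℤ
  realizingWeight T y e = ∑[ v < n G ] walkWeight (proj₂ (route v)) (T v) e + ∑[ z < n G ] loopWeight z (y z) e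

  weightSum-realizingWeight : ∀ T y z →
    weightSum (realizingWeight T y) z ≡ T z + (componentSum routeParity T z + loopGain z (y z))
  weightSum-realizingWeight T y z = begin
    weightSum (realizingWeight T y) z
      ≡⟨ weightSum-+ _ _ z ⟩
    weightSum (λ e → ∑[ v < n G ] walkWeight (proj₂ (route v)) (T v) e) z
      + weightSum (λ e → ∑[ z′ < n G ] loopWeight z′ (y z′) e) z
      ≡⟨ cong₂ _+_ (weightSum-∑ (λ v → walkWeight (proj₂ (route v)) (T v)) z)
                   (weightSum-∑ (λ z′ → loopWeight z′ (y z′)) z) ⟩
    ∑[ v < n G ] weightSum (walkWeight (proj₂ (route v)) (T v)) z
      + ∑[ z′ < n G ] weightSum (loopWeight z′ (y z′)) z
      ≡⟨ cong₂ _+_ (sum-cong-≗ λ v → weightSum-walkWeight (proj₂ (route v)) (T v) z)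
                   (sum-cong-≗ λ z′ → weightSum-loopWeight z′ (y z′) z) ⟩
    ∑[ v < n G ] ((v ↦ T v) z + (root v ↦ sign (routeParity v) (T v)) z)
      + ∑[ z′ < n G ] (z′ ↦ loopGain z′ (y z′)) z
      ≡⟨ cong₂ _+_ (∑-distrib-+ (λ v → (v ↦ T v) z) _) (∑-↦ (λ z′ → loopGain z′ (y z′)) z) ⟩
    ∑[ v < n G ] (v ↦ T v) z + componentSum routeParity T z + loopGain z (y z)
      ≡⟨ cong (λ x → x + componentSum routeParity T z + loopGain z (y z)) (∑-↦ T z) ⟩
    T z + componentSum routeParity T z + loopGain z (y z)
      ≡⟨ ℤ.+-assoc (T z) _ _ ⟩
    T z + (componentSum routeParity T z + loopGain z (y z)) ∎
    where open ≡-Reasoning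

  loopGain-odd : ∀ {z} y → OddClosedWalk z → loopGain z y ≡ y + y
  loopGain-odd {z} y odd with walk? true z z
  ... | yes _   = refl
  ... | no ¬odd = ⊥-elim (¬odd odd)

  loopGain-bipartite : ∀ {z} y → ¬ OddClosedWalk z → loopGain z y ≡ + 0
  loopGain-bipartite {z} y bipartite with walk? true z z
  ... | yes odd = ⊥-elim (bipartite odd)
  ... | no  _   = refl

  loopGain-zero : ∀ z → loopGain z (+ 0) ≡ + 0
  loopGain-zero z with walk? true z z
  ... | yes _ = refl
  ... | no  _ = refl

  balanced-odd : ∀ {t z} {f : Vertex → ℤ} → OddClosedWalk z → + 2 ∣ componentSum routeParity f z →
                 ∃ λ y → componentSum routeParity f z + loopGain z y ≡ + 0 mod t
  balanced-odd {z = z} {f} odd (divides q S≡2q) = - q , ≡⇒≡-mod (begin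
    componentSum routeParity f z + loopGain z (- q)   ≡⟨ cong₂ _+_ S≡2q (loopGain-odd (- q) odd) ⟩
    q * + 2 + (- q + - q)                             ≡⟨ cancel q ⟩
    + 0                                               ∎)
    where
    open ≡-Reasoning
    cancel : ∀ q → q * + 2 + (- q + - q) ≡ + 0
    cancel = solve-∀

  record ComponentTarget (t : ℕ) (z : Vertex) : Set where
    field
      target   : Vertex → ℕ
      bounded  : ∀ v → target v < t
      proper   : ∀ u v → root u ≡ z → Adjacent G u v → target u ≢ target v
      balanced : ∃ λ y → componentSum routeParity (+_ ∘ target) z + loopGain z y ≡ + 0 mod t

  admitsTwin-byComponents : ∀ t → (∀ z → root z ≡ z → ComponentTarget (ℕ.suc t) z) → AdmitsImproperTwin G (ℕ.suc t)
  admitsTwin-byComponents t targets =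
    admitsTwin-byWeights t (realizingWeight (+_ ∘ T) y) T T<t T-proper realized
    where
    open ComponentTarget
    open Decidable⇒UIP Fin._≟_ using (≡-irrelevant)

    T : Vertex → ℕ
    T v = target (targets (root v) (root-idem v)) v

    T-component : ∀ {v z} → root v ≡ z → (r : root z ≡ z) → T v ≡ target (targets z r) v
    T-component {v} refl r = cong (λ r′ → target (targets (root v) r′) v) (≡-irrelevant (root-idem v) r)

    T<t : ∀ v → T v < ℕ.suc t
    T<t v = bounded (targets (root v) (root-idem v)) v

    T-proper : ∀ u v → Adjacent G u v → T u ≢ T v
    T-proper u v a Tu≡Tv = proper (targets (root u) (root-idem u)) u v refl a
      (trans Tu≡Tv (T-component (sym (root-adjacent a)) (root-idem u)))

    balance : ∀ z → Dec (root z ≡ z) → ∃ λ y → componentSum routeParity (+_ ∘ T) z + loopGain z y ≡ + 0 mod ℕ.suc t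
    balance z (yes r) with balanced (targets z r)
    ... | y , b = y , ≡-mod-trans (≡⇒≡-mod (cong (λ s → s + loopGain z y) sameSum)) b
      where
      sameSum : componentSum routeParity (+_ ∘ T) z ≡ componentSum routeParity (+_ ∘ target (targets z r)) z
      sameSum = componentSum-cong routeParity routeParity _ _ λ v v∈z →
        cong (sign (routeParity v) ∘ +_) (T-component v∈z r)
    balance z (no ¬r) = + 0 , ≡⇒≡-mod (cong₂ _+_ (componentSum-nonroot routeParity (+_ ∘ T) ¬r) (loopGain-zero z))

    y : Vertex → ℤ
    y z = proj₁ (balance z (root z Fin.≟ z))

    realized : ∀ z → weightSum (realizingWeight (+_ ∘ T) y) z ≡ + T z mod ℕ.suc t
    realized z = begin
      weightSum (realizingWeight (+_ ∘ T) y) z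
        ≡⟨ weightSum-realizingWeight (+_ ∘ T) y z ⟩
      + T z + (componentSum routeParity (+_ ∘ T) z + loopGain z (y z))
        ≈⟨ +-congˡ-mod (+ T z) (proj₂ (balance z (root z Fin.≟ z))) ⟩
      + T z + + 0
        ≡⟨ ℤ.+-identityʳ (+ T z) ⟩
      + T z ∎
      where open ≡-mod-Reasoning (ℕ.suc t)

-- Non-bipartite components

module NonBipartite (G : Graph) (walk? : ∀ p u v → Dec (Walks.Walk G u v p))
                    (t k : ℕ) (k<t : ℕ.suc k < t) (c : Fin (n G) → ℕ) (c≤k : ∀ v → c v < ℕ.suc k)
                    (c-proper : ∀ u v → Adjacent G u v → c u ≢ c v) where

  open Walks G
  open Components G walk?

  recolouredTarget : ∀ {z} v₀ a → OddClosedWalk z → root v₀ ≡ z → a < t → (∀ w → Adjacent G v₀ w → c w ≢ a) →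
                     + 2 ∣ componentSum (const true) (+_ ∘ c) z + (+ a - + c v₀) → ComponentTarget t z
  recolouredTarget {z} v₀ a odd v₀∈z a<t a-fresh even = record
    { target   = c′
    ; bounded  = bounded
    ; proper   = proper
    ; balanced = balanced-odd odd (subst (+ 2 ∣_) (sym total≡) even)
    }
    where
    c′ = updateAt c v₀ (const a)

    bounded : ∀ v → c′ v < t
    bounded = updateAt-< c v₀ (λ v → ℕ.<-trans (c≤k v) k<t) a<t

    at : c′ v₀ ≡ a
    at = updateAt-updates v₀ c

    off : ∀ {v} → v ≢ v₀ → c′ v ≡ c v
    off v≢v₀ = updateAt-minimal _ v₀ c v≢v₀

    proper : ∀ u v → root u ≡ z → Adjacent G u v → c′ u ≢ c′ v
    proper u v _ u~v with u Fin.≟ v₀ | v Fin.≟ v₀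
    ... | yes refl | yes refl = ⊥-elim (adjacent-irrefl u~v)
    ... | yes refl | no v≢v₀  = λ eq → a-fresh v u~v (trans (sym (off v≢v₀)) (trans (sym eq) at))
    ... | no u≢v₀  | yes refl = λ eq → a-fresh u (adjacent-sym u~v) (trans (sym (off u≢v₀)) (trans eq at))
    ... | no u≢v₀  | no v≢v₀  = λ eq → c-proper u v u~v (trans (sym (off u≢v₀)) (trans eq (off v≢v₀)))

    total≡ : componentSum routeParity (+_ ∘ c′) z ≡ componentSum (const true) (+_ ∘ c) z + (+ a - + c v₀)
    total≡ = trans (componentSum-cong routeParity (const true) _ _ λ v v∈z →
                     cong (λ p → sign p (+ c′ v)) (routeParity-odd v∈z odd))
                   (componentSum-updateAt (const true) c a v₀∈z)

  nonBipartiteTarget : ∀ {z} → root z ≡ z → OddClosedWalk z → ComponentTarget t z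
  nonBipartiteTarget {z} z-root odd with + 2 ∣? S
    where S = componentSum (const true) (+_ ∘ c) z
  ... | yes 2∣S =
    recolouredTarget z (c z) odd z-root (ℕ.<-trans (c≤k z) k<t) (λ w z~w → c-proper z w z~w ∘ sym)
      (subst (+ 2 ∣_) (sym (+-inverse-cancel _ (+ c z))) 2∣S)
    where
    +-inverse-cancel : ∀ s x → s + (x - x) ≡ s
    +-inverse-cancel = solve-∀
  ... | no ¬2∣S with Fin.any? (λ v → (root v Fin.≟ z) ×-dec ¬? (+ 2 ∣? + ℕ.suc k - + c v))
  ...   | yes (v₀ , v₀∈z , odd-gap) =
    recolouredTarget v₀ (ℕ.suc k) odd v₀∈z k<t (λ w _ cw≡k → ℕ.<-irrefl cw≡k (c≤k w)) (odd+odd ¬2∣S odd-gap)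
  ...   | no no-odd-gap =
    recolouredTarget z k odd z-root (ℕ.<-trans (ℕ.n<1+n k) k<t) fresh
      (odd+odd ¬2∣S (subst (λ x → ¬ (+ 2 ∣ x)) (shift (+ c z)) (even⇒odd-pred (even-gap z z-root))))
    where
    even-gap : ∀ v → root v ≡ z → + 2 ∣ + ℕ.suc k - + c v
    even-gap v v∈z = decidable-stable (+ 2 ∣? _) λ odd-gap → no-odd-gap (v , v∈z , odd-gap)
    shift : ∀ x → + ℕ.suc k - x - + 1 ≡ + k - x
    shift x = trans (cong (λ y → y - x - + 1) (ℤ.pos-+ 1 k)) (regroup (+ k) x)
      where
      regroup : ∀ k x → + 1 + k - x - + 1 ≡ k - x
      regroup = solve-∀
    fresh : ∀ w → Adjacent G z w → c w ≢ k
    fresh w z~w cw≡k = ¬2∣1 (subst (+ 2 ∣_) gap-one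
      (subst (λ x → + 2 ∣ + ℕ.suc k - + x) cw≡k (even-gap w (trans (sym (root-adjacent z~w)) z-root))))
      where
      gap-one : + ℕ.suc k - + k ≡ + 1
      gap-one = trans (cong (_- + k) (ℤ.pos-+ 1 k)) (cancel (+ k))
        where
        cancel : ∀ k → + 1 + k - k ≡ + 1
        cancel = solve-∀

-- Bipartite components; the near side contains the root, the far side does not

module Bipartite (G : Graph) (walk? : ∀ p u v → Dec (Walks.Walk G u v p)) (nice : Nice G)
                 (t : ℕ) (2≤t : 2 ℕ.≤ t) where

  open Walks G
  open Components G walk?
  open ≡-mod-Reasoning (ℕ.suc t)

  -- κ reads the side off a colour, so adjacent vertices, lying on opposite sides, get distinct colours.
  classifiedTarget : ∀ {z} → ¬ OddClosedWalk z → (τ : Vertex → ℕ) (κ : ℕ → Bool) → (∀ v → τ v < ℕ.suc t) →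
                     (∀ v → root v ≡ z → κ (τ v) ≡ side v) → componentSum side (+_ ∘ τ) z ≡ + 0 mod ℕ.suc t →
                     ComponentTarget (ℕ.suc t) z
  classifiedTarget {z} bipartite τ κ τ<t κτ≡side signed≡0 = record
    { target   = τ
    ; bounded  = τ<t
    ; proper   = λ u v u∈z u~v τu≡τv → not-¬ (trans (sym (κτ≡side v (trans (sym (root-adjacent u~v)) u∈z)))
                   (trans (cong κ (sym τu≡τv)) (κτ≡side u u∈z))) (side-adjacent u∈z bipartite u~v)
    ; balanced = + 0 , (begin
        componentSum routeParity (+_ ∘ τ) z + loopGain z (+ 0)
          ≡⟨ cong₂ _+_ (componentSum-cong routeParity side _ _ λ v v∈z →
                          cong (λ p → sign p (+ τ v)) (routeParity-bipartite v∈z bipartite))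
                       (loopGain-bipartite (+ 0) bipartite) ⟩
        componentSum side (+_ ∘ τ) z + + 0   ≡⟨ ℤ.+-identityʳ _ ⟩
        componentSum side (+_ ∘ τ) z         ≈⟨ signed≡0 ⟩
        + 0                                  ∎)
    }

  κ-updateAt : ∀ {z} (κ : ℕ → Bool) τ v₀ {a} → (∀ v → root v ≡ z → κ (τ v) ≡ side v) → κ a ≡ side v₀ →
               ∀ v → root v ≡ z → κ (updateAt τ v₀ (const a) v) ≡ side v
  κ-updateAt κ τ v₀ κτ≡side κa≡side v v∈z with v Fin.≟ v₀
  ... | yes refl = trans (cong κ (updateAt-updates v₀ τ)) κa≡side
  ... | no v≢v₀  = trans (cong κ (updateAt-minimal v v₀ τ v≢v₀)) (κτ≡side v v∈z)

  bit : Bool → ℕ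
  bit true  = 1
  bit false = 0

  bit<t : ∀ b → bit b < ℕ.suc t
  bit<t true  = ℕ.s≤s (ℕ.<⇒≤ 2≤t)
  bit<t false = ℕ.s≤s ℕ.z≤n

  sideBit : Vertex → ℕ
  sideBit = bit ∘ side

  farCount : Vertex → ℤ
  farCount = componentSum side (+_ ∘ sideBit)

  isOne isOneOrTwo : ℕ → Bool
  isOne x      = does (x ℕ.≟ 1)
  isOneOrTwo x = does (x ℕ.≟ 1) ∨ does (x ℕ.≟ 2)

  isOneOrTwo-3% : ∀ s → 2 ℕ.≤ s → isOneOrTwo (3 ℕ.% ℕ.suc s) ≡ false
  isOneOrTwo-3% (ℕ.suc (ℕ.suc ℕ.zero))    _ = refl
  isOneOrTwo-3% (ℕ.suc (ℕ.suc (ℕ.suc s))) _ =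
    cong isOneOrTwo (ℕ.m<n⇒m%n≡m {n = 4 ℕ.+ s} (ℕ.s≤s (ℕ.s≤s (ℕ.s≤s (ℕ.s≤s ℕ.z≤n)))))
  isOneOrTwo-3% (ℕ.suc ℕ.zero) (ℕ.s≤s ())

  signedBit-side : ∀ {v b} x → side v ≡ b → sign (side v) (x - + sideBit v) ≡ sign b (x - + bit b)
  signedBit-side x refl = refl

  isOne-bit : ∀ {z} v → root v ≡ z → isOne (sideBit v) ≡ side v
  isOne-bit v _ with side v
  ... | true  = refl
  ... | false = refl

  isOneOrTwo-bit : ∀ {z} v → root v ≡ z → isOneOrTwo (sideBit v) ≡ side v
  isOneOrTwo-bit v _ with side v
  ... | true  = refl
  ... | false = refl

  module _ {z} (z-root : root z ≡ z) (bipartite : ¬ OddClosedWalk z) where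

    z-near : side z ≡ false
    z-near = side-root z-root bipartite

    rootFixedTarget : farCount z %ℕ ℕ.suc t ≢ 1 → ComponentTarget (ℕ.suc t) z
    rootFixedTarget r≢1 = classifiedTarget bipartite τ isOne
      (updateAt-< sideBit z (bit<t ∘ side) (n%ℕd<d (farCount z) (ℕ.suc t)))
      (κ-updateAt isOne sideBit z isOne-bit (trans (dec-false (r ℕ.≟ 1) r≢1) (sym z-near)))
      (begin
        componentSum side (+_ ∘ τ) z
          ≡⟨ componentSum-updateAt side sideBit r z-root ⟩
        farCount z + sign (side z) (+ r - + sideBit z)
          ≡⟨ cong (λ b → farCount z + sign b (+ r - + bit b)) z-near ⟩
        farCount z + - (+ r - + 0)
          ≈⟨ +-congˡ-mod (farCount z) (neg-cong-mod (+-congʳ-mod (- + 0) (%ℕ-mod (farCount z)))) ⟩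
        farCount z + - (farCount z - + 0)
          ≡⟨ cancel (farCount z) ⟩
        + 0 ∎)
      where
      r = farCount z %ℕ ℕ.suc t
      τ = updateAt sideBit z (const r)
      cancel : ∀ x → x + - (x - + 0) ≡ + 0
      cancel = solve-∀

    DistinctFarPair : Set
    DistinctFarPair = ∃₂ λ x₀ x₁ → root x₀ ≡ z × side x₀ ≡ true × root x₁ ≡ z × side x₁ ≡ true × x₀ ≢ x₁

    nearVertexTarget : farCount z ≡ + 1 mod ℕ.suc t → ∀ y₁ → root y₁ ≡ z → side y₁ ≡ false → y₁ ≢ z →
                       ComponentTarget (ℕ.suc t) z
    nearVertexTarget N≡1 y₁ y₁∈z y₁-near y₁≢z = classifiedTarget bipartite τ isOne
      (updateAt-< τ₁ z (updateAt-< sideBit y₁ (bit<t ∘ side) (ℕ.s≤s 2≤t)) (ℕ.n<1+n t))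
      (κ-updateAt isOne τ₁ z (κ-updateAt isOne sideBit y₁ isOne-bit (sym y₁-near))
        (trans (dec-false (t ℕ.≟ 1) (λ t≡1 → ℕ.<-irrefl (sym t≡1) 2≤t)) (sym z-near)))
      (begin
        componentSum side (+_ ∘ τ) z
          ≡⟨ componentSum-updateAt side τ₁ t z-root ⟩
        componentSum side (+_ ∘ τ₁) z + sign (side z) (+ t - + τ₁ z)
          ≡⟨ cong₂ _+_ (componentSum-updateAt side sideBit 2 y₁∈z)
                       (cong (λ x → sign (side z) (+ t - + x)) (updateAt-minimal z y₁ sideBit (y₁≢z ∘ sym))) ⟩
        farCount z + sign (side y₁) (+ 2 - + sideBit y₁) + sign (side z) (+ t - + sideBit z)
          ≡⟨ cong₂ (λ b b′ → farCount z + sign b (+ 2 - + bit b) + sign b′ (+ t - + bit b′)) y₁-near z-near ⟩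
        farCount z + - (+ 2 - + 0) + - (+ t - + 0)
          ≈⟨ +-congʳ-mod (- (+ t - + 0)) (+-congʳ-mod (- (+ 2 - + 0)) N≡1) ⟩
        + 1 + - (+ 2 - + 0) + - (+ t - + 0)
          ≡⟨ regroup (+ t) ⟩
        - + 1 * (+ 1 + + t)
          ≡⟨ cong (λ x → - + 1 * x) (ℤ.pos-+ 1 t) ⟨
        - + 1 * + ℕ.suc t
          ≈⟨ multiple-mod (- + 1) ⟩
        + 0 ∎)
      where
      τ₁ = updateAt sideBit y₁ (const 2)
      τ  = updateAt τ₁ z (const t)
      regroup : ∀ t → + 1 + - (+ 2 - + 0) + - (t - + 0) ≡ - + 1 * (+ 1 + t)
      regroup = solve-∀

    farPairTarget : farCount z ≡ + 1 mod ℕ.suc t → DistinctFarPair → ComponentTarget (ℕ.suc t) z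
    farPairTarget N≡1 (x₀ , x₁ , x₀∈z , x₀-far , x₁∈z , x₁-far , x₀≢x₁) = classifiedTarget bipartite τ isOneOrTwo
      (updateAt-< τ₂ z (updateAt-< τ₁ x₀ (updateAt-< sideBit x₁ (bit<t ∘ side) 2<t) 2<t) (ℕ.m%n<n 3 (ℕ.suc t)))
      (κ-updateAt isOneOrTwo τ₂ z
        (κ-updateAt isOneOrTwo τ₁ x₀ (κ-updateAt isOneOrTwo sideBit x₁ isOneOrTwo-bit (sym x₁-far)) (sym x₀-far))
        (trans (isOneOrTwo-3% t 2≤t) (sym z-near)))
      (begin
        componentSum side (+_ ∘ τ) z
          ≡⟨ componentSum-updateAt side τ₂ r z-root ⟩
        componentSum side (+_ ∘ τ₂) z + sign (side z) (+ r - + τ₂ z)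
          ≡⟨ cong₂ _+_ (componentSum-updateAt side τ₁ 2 x₀∈z)
                       (cong (λ x → sign (side z) (+ r - + x))
                             (trans (updateAt-minimal z x₀ τ₁ (z≢far x₀-far))
                                    (updateAt-minimal z x₁ sideBit (z≢far x₁-far)))) ⟩
        componentSum side (+_ ∘ τ₁) z + sign (side x₀) (+ 2 - + τ₁ x₀) + sign (side z) (+ r - + sideBit z)
          ≡⟨ cong₂ (λ a b → a + b + sign (side z) (+ r - + sideBit z)) (componentSum-updateAt side sideBit 2 x₁∈z)
                   (cong (λ x → sign (side x₀) (+ 2 - + x)) (updateAt-minimal x₀ x₁ sideBit x₀≢x₁)) ⟩
        farCount z + sign (side x₁) (+ 2 - + sideBit x₁) + sign (side x₀) (+ 2 - + sideBit x₀)
          + sign (side z) (+ r - + sideBit z)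
          ≡⟨ cong₂ _+_ (cong₂ (λ a b → farCount z + a + b)
                              (signedBit-side (+ 2) x₁-far) (signedBit-side (+ 2) x₀-far))
                       (signedBit-side (+ r) z-near) ⟩
        farCount z + (+ 2 - + 1) + (+ 2 - + 1) + - (+ r - + 0)
          ≈⟨ +-congʳ-mod (- (+ r - + 0)) (+-congʳ-mod (+ 2 - + 1) (+-congʳ-mod (+ 2 - + 1) N≡1)) ⟩
        + 1 + (+ 2 - + 1) + (+ 2 - + 1) + - (+ r - + 0)
          ≈⟨ +-congˡ-mod (+ 1 + (+ 2 - + 1) + (+ 2 - + 1)) (neg-cong-mod (+-congʳ-mod (- + 0) (%ℕ-mod (+ 3)))) ⟩
        + 1 + (+ 2 - + 1) + (+ 2 - + 1) + - (+ 3 - + 0)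
          ≡⟨⟩
        + 0 ∎)
      where
      2<t : 2 < ℕ.suc t
      2<t = ℕ.s≤s 2≤t
      r  = 3 ℕ.% ℕ.suc t
      τ₁ = updateAt sideBit x₁ (const 2)
      τ₂ = updateAt τ₁ x₀ (const 2)
      τ  = updateAt τ₂ z (const r)
      z≢far : ∀ {x} → side x ≡ true → z ≢ x
      z≢far x-far z≡x with () ← trans (sym x-far) (trans (cong side (sym z≡x)) z-near)

    farVertex : farCount z ≢ + 0 → ∃ λ x → root x ≡ z × side x ≡ true
    farVertex N≢0 with ∑-nonzero _ N≢0
    ... | x , term≢0 with side x in x-far
    ...   | false = ⊥-elim (term≢0 (↦-zero (root x) z))
    ...   | true  = x , decidable-stable (root x Fin.≟ z) (λ x∉z → term≢0 (↦-≢ _ x∉z)) , x-far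

    module _ (z-onlyNear : ∀ v → root v ≡ z → side v ≡ false → v ≡ z) where

      farNeighbour≡z : ∀ {x w} → root x ≡ z → side x ≡ true → Adjacent G x w → w ≡ z
      farNeighbour≡z x∈z x-far x~w = z-onlyNear _ (trans (sym (root-adjacent x~w)) x∈z)
        (trans (side-adjacent x∈z bipartite x~w) (cong not x-far))

      farPair : farCount z ≢ + 0 → DistinctFarPair
      farPair N≢0 with farVertex N≢0
      ... | x₀ , x₀∈z , x₀-far with firstStep (proj₂ (root-connected x₀)) x₀-far
      ...   | w , x₀~w with farNeighbour≡z x₀∈z x₀-far x₀~w
      ...     | refl with nice⇒adjacentEdge nice x₀~w
      ...       | f , f≢e₀ , inj₁ f-at-x₀ with incident⇒adjacent f-at-x₀
      ...         | q , x₀~q , edge≡f with farNeighbour≡z x₀∈z x₀-far x₀~q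
      ...           | refl = ⊥-elim (f≢e₀ (trans (sym edge≡f) (edge-unique x₀~q x₀~w)))
      farPair N≢0 | x₀ , x₀∈z , x₀-far | _ , x₀~z | refl | f , f≢e₀ , inj₂ f-at-z with incident⇒adjacent f-at-z
      ... | x₁ , z~x₁ , edge≡f = x₀ , x₁ , x₀∈z , x₀-far , trans (sym (root-adjacent z~x₁)) z-root ,
        trans (side-adjacent z-root bipartite z~x₁) (cong not z-near) ,
        λ { refl → f≢e₀ (trans (sym edge≡f) (edge-unique z~x₁ (adjacent-sym x₀~z))) }

    bipartiteTarget : ComponentTarget (ℕ.suc t) z
    bipartiteTarget with farCount z %ℕ ℕ.suc t ℕ.≟ 1
    ... | no  r≢1 = rootFixedTarget r≢1
    ... | yes r≡1 = farCountOne r≡1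
                      (Fin.any? λ v → (root v Fin.≟ z) ×-dec ((side v Bool.≟ false) ×-dec ¬? (v Fin.≟ z)))
      where
      farCountOne : farCount z %ℕ ℕ.suc t ≡ 1 →
                    Dec (∃ λ v → root v ≡ z × side v ≡ false × v ≢ z) → ComponentTarget (ℕ.suc t) z
      farCountOne r≡1 (yes (y₁ , y₁∈z , y₁-near , y₁≢z)) = nearVertexTarget N≡1 y₁ y₁∈z y₁-near y₁≢z
        where N≡1 = ≡-mod-trans (≡-mod-sym (%ℕ-mod (farCount z))) (≡⇒≡-mod (cong +_ r≡1))
      farCountOne r≡1 (no no-other-near) = farPairTarget N≡1 (farPair z-onlyNear N≢0)
        where
        N≡1 = ≡-mod-trans (≡-mod-sym (%ℕ-mod (farCount z))) (≡⇒≡-mod (cong +_ r≡1))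
        z-onlyNear : ∀ v → root v ≡ z → side v ≡ false → v ≡ z
        z-onlyNear v v∈z v-near = decidable-stable (v Fin.≟ z) λ v≢z → no-other-near (v , v∈z , v-near , v≢z)
        N≢0 : farCount z ≢ + 0
        N≢0 N≡0 with () ← trans (sym (cong (_%ℕ ℕ.suc t) N≡0)) r≡1

-- Deciding the existence of a colouring

module _ (G : Graph) where

  adjacent? : ∀ u v → Dec (Adjacent G u v)
  adjacent? u v = Fin.any? λ e → ends? e (u , v) ⊎-dec ends? e (v , u)
    where
    ends? = λ e → ≡-dec Fin._≟_ Fin._≟_ (ends G e)

  vertexSum-cong : ∀ k {s s′ : Fin (m G) → Fin k} → (∀ e → s e ≡ s′ e) →
                   ∀ v → vertexSum G k s v ≡ vertexSum G k s′ v
  vertexSum-cong ℕ.zero    s≗s′ v = refl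
  vertexSum-cong (ℕ.suc k) {s} {s′} s≗s′ v =
    cong (λ xs → listSum xs ℕ.% ℕ.suc k) (Data.List.Properties.map-cong contrib≗ (allFin (m G)))
    where
    contrib≗ : ∀ e → contrib G s v e ≡ contrib G s′ v e
    contrib≗ e with proj₁ (ends G e) Fin.≟ v | proj₂ (ends G e) Fin.≟ v
    ... | yes _ | _     = cong toℕ (s≗s′ e)
    ... | no  _ | yes _ = cong toℕ (s≗s′ e)
    ... | no  _ | no  _ = refl

  twinColouring? : ∀ k (s : Fin (m G) → Fin k) → Dec (IsImproperTwinColoring G k s)
  twinColouring? k s = Fin.all? λ u → Fin.all? λ v →
    adjacent? u v →-dec ¬? (vertexSum G k s u ℕ.≟ vertexSum G k s v)

  admitsTwin? : ∀ k → Dec (AdmitsImproperTwin G k)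
  admitsTwin? k = map′ (λ (i , twin) → finToFun i , twin) (λ (s , twin) → funToFin s , respects s twin)
                       (Fin.any? λ i → twinColouring? k (finToFun i))
    where
    respects : ∀ s → IsImproperTwinColoring G k s → IsImproperTwinColoring G k (finToFun (funToFin s))
    respects s twin u v u~v eq = twin u v u~v
      (trans (vertexSum-cong k (sym ∘ finToFun-funToFin s) u)
             (trans eq (vertexSum-cong k (finToFun-funToFin s) v)))

¬¬-∀-Bool : {P : Bool → Set} → (∀ b → ¬ ¬ P b) → ¬ ¬ (∀ b → P b)
¬¬-∀-Bool ¬¬P ¬∀ = ¬¬P true λ Ptrue → ¬¬P false λ Pfalse → ¬∀ λ { true → Ptrue ; false → Pfalse }

¬¬-∀-Fin : {P : Fin N → Set} → (∀ i → ¬ ¬ P i) → ¬ ¬ (∀ i → P i)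
¬¬-∀-Fin {ℕ.zero}  _   ¬∀ = ¬∀ λ ()
¬¬-∀-Fin {ℕ.suc N} ¬¬P ¬∀ = ¬¬P zero λ P0 → ¬¬-∀-Fin (¬¬P ∘ suc) λ Psuc → ¬∀ λ { zero → P0 ; (suc i) → Psuc i }

¬¬-walk? : (G : Graph) → ¬ ¬ (∀ p u v → Dec (Walks.Walk G u v p))
¬¬-walk? G = ¬¬-∀-Bool λ p → ¬¬-∀-Fin λ u → ¬¬-∀-Fin λ v → ¬¬-excluded-middle

admitsTwin-givenWalks : (G : Graph) → Nice G → (walk? : ∀ p u v → Dec (Walks.Walk G u v p)) →
                        ∀ k t → 2 ℕ.≤ k → k < ℕ.suc t → AdmitsImproperTwin G k → AdmitsImproperTwin G (ℕ.suc t)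
admitsTwin-givenWalks G nice walk? (ℕ.suc k) t 2≤k k<t (s , twin) = admitsTwin-byComponents t target
  where
  open Walks G
  open Components G walk?

  c : Vertex → ℕ
  c = vertexSum G (ℕ.suc k) s

  c<k : ∀ v → c v < ℕ.suc k
  c<k v = ℕ.m%n<n (listSum (map (contrib G s v) (allFin (m G)))) (ℕ.suc k)

  target : ∀ z → root z ≡ z → ComponentTarget (ℕ.suc t) z
  target z z-root with walk? true z z
  ... | yes odd      = NonBipartite.nonBipartiteTarget G walk? (ℕ.suc t) k k<t c c<k twin z-root odd
  ... | no bipartite = Bipartite.bipartiteTarget G walk? nice t (ℕ.≤-trans 2≤k (ℕ.s≤s⁻¹ k<t)) z-root bipartite

theorem3 : (G : Graph) → Nice G → (k : ℕ) → k ≥ 2 →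
    AdmitsImproperTwin G k → (t : ℕ) → t ≥ k → AdmitsImproperTwin G t
theorem3 G nice k k≥2 admits t t≥k with ℕ.m≤n⇒m<n∨m≡n t≥k
... | inj₂ refl = admits
theorem3 G nice k k≥2 admits (ℕ.suc t) t≥k | inj₁ k<t =
  decidable-stable (admitsTwin? G (ℕ.suc t))
    (¬¬-map (λ walk? → admitsTwin-givenWalks G nice walk? k t k≥2 k<t admits) (¬¬-walk? G))
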